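{- Let $k\ge2$ and let $G$ be a strong $k$-chromatic-choosable graph. Let $A,B\subseteq V(G)$ with $A\cup B=V(G)$, and let $C=A\cap B$, where $|A|>|C|$, $|B|>|C|$, $0<|C|\le3$ if $k$ is even, and $0<|C|\le4$ if $k$ is odd. Form $G'$ by adding to $G$ two new vertices $u$ and $s$, with $u$ adjacent to every vertex of $A$ and $s$ adjacent to every vertex of $B$. If $\chi(G')>k$, then $G'$ is strong $(k+1)$-chromatic-choosable.
   Context: A list assignment gives each vertex a color set; a $k$-assignment has all lists of size $k$; $G$ is $L$-colorable if it has a proper coloring choosing each vertex's color from its list. A list assignment is constant if all lists are equal. $G$ is strong $k$-chromatic-choosable if $\chi(G)=k$ and every $(k-1)$-assignment $L$ for which $G$ is not $L$-colorable is constant. -}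

module Defs where

open import Data.Nat using (ℕ; zero; suc; _∸_; _<_)
open import Data.Bool using (Bool; true; false)
open import Data.Fin using (Fin; zero; suc)
open import Data.Fin.Subset using (Subset; _∈_)
open import Data.Vec using (lookup)
open import Data.List using (List; length)
open import Data.List.Relation.Unary.Unique.Propositional using (Unique)
import Data.List.Membership.Propositional as LM
open import Data.Product using (Σ; ∃; _×_; _,_)
open import Relation.Binary.PropositionalEquality using (_≡_; _≢_; refl)
open import Relation.Nullary using (¬_)
open import Function.Bundles using (_⇔_)

record Graph (n : ℕ) : Set where
  field
    adj     : Fin n → Fin n → Bool
    sym     : ∀ u v → adj u v ≡ adj v u
    irrefl  : ∀ v → adj v v ≡ false
open Graph public

Proper : ∀ {n} {X : Set} → Graph n → (Fin n → X) → Set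
Proper G c = ∀ u v → adj G u v ≡ true → c u ≢ c v

Colorable : ∀ {n} → Graph n → ℕ → Set
Colorable {n} G m = Σ (Fin n → Fin m) λ c → Proper G c

ChromaticNumber : ∀ {n} → Graph n → ℕ → Set
ChromaticNumber G k = Colorable G k × (∀ m → m < k → ¬ Colorable G m)

-- List assignment: each vertex gets a finite set of colours (natural numbers),
-- represented as a duplicate-free list.
ListAssignment : ℕ → Set
ListAssignment n = Fin n → List ℕ

IsAssignment : ∀ {n} → ℕ → ListAssignment n → Set
IsAssignment k L = ∀ v → Unique (L v) × length (L v) ≡ k

LColorable : ∀ {n} → Graph n → ListAssignment n → Set
LColorable {n} G L = Σ (Fin n → ℕ) λ c → (∀ v → c v LM.∈ L v) × Proper G c

Constant : ∀ {n} → ListAssignment n → Set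
Constant L = ∀ u v x → (x LM.∈ L u) ⇔ (x LM.∈ L v)

StrongChromaticChoosable : ∀ {n} → Graph n → ℕ → Set
StrongChromaticChoosable {n} G k =
  ChromaticNumber G k ×
  (∀ (L : ListAssignment n) → IsAssignment (k ∸ 1) L → ¬ LColorable G L → Constant L)

-- G' : add two new vertices u = zero and s = suc zero; old vertex v becomes suc (suc v).
-- u is adjacent exactly to the vertices of A, s exactly to the vertices of B, u ≁ s.
extAdj : ∀ {n} → Graph n → Subset n → Subset n → Fin (suc (suc n)) → Fin (suc (suc n)) → Bool
extAdj G A B zero zero = false
extAdj G A B zero (suc zero) = false
extAdj G A B zero (suc (suc v)) = lookup A v
extAdj G A B (suc zero) zero = false
extAdj G A B (suc zero) (suc zero) = false
extAdj G A B (suc zero) (suc (suc v)) = lookup B v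
extAdj G A B (suc (suc v)) zero = lookup A v
extAdj G A B (suc (suc v)) (suc zero) = lookup B v
extAdj G A B (suc (suc v)) (suc (suc w)) = adj G v w

extSym : ∀ {n} (G : Graph n) A B u v → extAdj G A B u v ≡ extAdj G A B v u
extSym G A B zero zero = refl
extSym G A B zero (suc zero) = refl
extSym G A B zero (suc (suc v)) = refl
extSym G A B (suc zero) zero = refl
extSym G A B (suc zero) (suc zero) = refl
extSym G A B (suc zero) (suc (suc v)) = refl
extSym G A B (suc (suc v)) zero = refl
extSym G A B (suc (suc v)) (suc zero) = refl
extSym G A B (suc (suc v)) (suc (suc w)) = sym G v w

extIrrefl : ∀ {n} (G : Graph n) A B v → extAdj G A B v v ≡ false
extIrrefl G A B zero = refl
extIrrefl G A B (suc zero) = refl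
extIrrefl G A B (suc (suc v)) = irrefl G v

extend : ∀ {n} → Graph n → Subset n → Subset n → Graph (suc (suc n))
extend G A B = record { adj = extAdj G A B ; sym = extSym G A B ; irrefl = extIrrefl G A B }

{-# OPTIONS --safe #-}
module Submission where

-- Let L be a k-assignment of G′ with no L-colouring, and colour u by a ∈ L(u) and s by
-- b ∈ L(s). What remains for G is the residual assignment: L(v) minus a if v ∈ A and
-- minus b if v ∈ B. If no vertex of A ∩ B has both a and b in its list, every residual
-- list keeps at least k − 1 colours, so strong choosability of G makes the residual
-- lists one common (k − 1)-set; in particular a ∈ L(w) for w ∈ A ∖ B and b ∈ L(w) for
-- w ∈ B ∖ A. If L(u) and L(s) share a colour a, taking b = a shows that L is constant.
-- If they are disjoint, count pairs: a vertex of A ∩ B whose list meets L(u) in p and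
-- L(s) in q colours blocks pq ≤ ⌊k²/4⌋ of the k² pairs (a, b), so at most 3 (for odd k,
-- 4) vertices leave some pair unblocked. The resulting residual lists force
-- L(u) = L(w_A) and L(s) = L(w_B) and contain a colour of both, a contradiction.

open import Defs hiding (sym)
open import Data.Nat using (ℕ; zero; suc; _≤_; _<_; _%_; _+_; _*_; z≤n; s≤s)
open import Data.Nat.Properties
open import Data.Nat.ListAction using (sum)
open import Data.Nat.DivMod using (m%n<n; m%n≤m; [m+kn]%n≡m%n)
open import Data.Nat.Tactic.RingSolver using (solve-∀)
open import Data.Bool using (false)
open import Data.Fin as Fin using (Fin; zero; suc; fromℕ; inject₁; inject≤)
open import Data.Fin.Properties using (¬∀⟶∃¬; fromℕ≢inject₁; inject₁-injective; inject≤-injective)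
open import Data.Fin.Subset using (Subset; _∩_; _∪_; ⊤; ∣_∣; inside; outside)
  renaming (_∈_ to _∈ₛ_; _∉_ to _∉ₛ_)
open import Data.Fin.Subset.Properties using (p⊆q⇒∣p∣≤∣q∣; x∈p∩q⁺; ∩-comm)
  renaming (_∈?_ to _∈ₛ?_)
open import Data.Vec using ([]; _∷_)
import Data.Vec as Vec
open import Data.Vec.Properties using (lookup⇒[]=)
open import Data.Vec.Functional using (updateAt)
open import Data.Vec.Functional.Properties using (updateAt-updates; updateAt-minimal)
open import Data.List using (List; []; _∷_; _++_; length; map; filter; take; concatMap; cartesianProduct)
open import Data.List.Properties using (length-++; length-++-sucʳ; length-map; length-take; take-all)
open import Data.List.Membership.Propositional using (_∈_; find)
open import Data.List.Membership.Propositional.Properties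
  using ( ∈-∃++; ∈-filter⁺; ∈-filter⁻; ∈-++⁻; ∈-++⁺ˡ; ∈-++⁺ʳ; ∈-map⁺; ∈-concat⁺′
        ; ∈-cartesianProduct⁺; ∈-cartesianProduct⁻)
open import Data.List.Membership.DecPropositional _≟_ using (_∈?_)
open import Data.List.Relation.Binary.Subset.Propositional using (_⊆_)
open import Data.List.Relation.Binary.Sublist.Propositional.Properties using (take-⊆; Any-resp-⊆)
open import Data.List.Relation.Binary.Disjoint.Propositional using (Disjoint)
open import Data.List.Relation.Unary.Any as Any using (Any; here; there)
open import Data.List.Relation.Unary.All as All using (All; []; _∷_)
open import Data.List.Relation.Unary.All.Properties using (¬All⇒Any¬; All¬⇒¬Any; ¬Any⇒All¬; map⁺)
open import Data.List.Relation.Unary.AllPairs using (_∷_)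
open import Data.List.Relation.Unary.Unique.Propositional using (Unique)
import Data.List.Relation.Unary.Unique.Propositional.Properties as Unique
open import Data.Product using (∃; _×_; _,_; proj₁; proj₂)
open import Data.Sum using (_⊎_; inj₁; inj₂)
open import Function using (_∘_; case_of_)
open import Function.Bundles using (_⇔_; mk⇔; Equivalence)
open Equivalence using (to)
open import Relation.Nullary using (¬_; yes; no; contradiction)
open import Relation.Nullary.Decidable using (¬?; _×-dec_; _⊎-dec_; _→-dec_; decidable-stable)
open import Relation.Unary using (Decidable)
open import Relation.Binary.Definitions using (DecidableEquality)
open import Relation.Binary.PropositionalEquality
  using (_≡_; _≢_; refl; sym; trans; cong; cong₂; subst; subst₂; module ≡-Reasoning)

Unique-⊆⇒length≤ : ∀ {A : Set} {xs ys : List A} → Unique xs → xs ⊆ ys → length xs ≤ length ys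
Unique-⊆⇒length≤ {xs = []}     _             _      = z≤n
Unique-⊆⇒length≤ {xs = x ∷ xs} (x∉xs ∷ uniq) x∷xs⊆ys with ∈-∃++ (x∷xs⊆ys (here refl))
... | as , bs , refl = begin
  suc (length xs)            ≤⟨ s≤s (Unique-⊆⇒length≤ uniq xs⊆as++bs) ⟩
  suc (length (as ++ bs))    ≡⟨ length-++-sucʳ as x bs ⟨
  length (as ++ x ∷ bs)      ∎
  where
  open ≤-Reasoning
  xs⊆as++bs : xs ⊆ as ++ bs
  xs⊆as++bs z∈xs with ∈-++⁻ as (x∷xs⊆ys (there z∈xs))
  ... | inj₁ z∈as         = ∈-++⁺ˡ z∈as
  ... | inj₂ (here refl)  = contradiction z∈xs (All¬⇒¬Any x∉xs)
  ... | inj₂ (there z∈bs) = ∈-++⁺ʳ as z∈bs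

Unique-⊆-length≥⇒⊇ : ∀ {A : Set} → DecidableEquality A → {xs ys : List A} →
                     Unique xs → xs ⊆ ys → length ys ≤ length xs → ys ⊆ xs
Unique-⊆-length≥⇒⊇ _≟ᴬ_ {xs} uniq xs⊆ys ys≤xs {y} y∈ys with Any.any? (y ≟ᴬ_) xs
... | yes y∈xs = y∈xs
... | no  y∉xs = contradiction ys≤xs (<⇒≱ (Unique-⊆⇒length≤ (¬Any⇒All¬ xs y∉xs ∷ uniq) y∷xs⊆ys))
  where
  y∷xs⊆ys : y ∷ xs ⊆ _
  y∷xs⊆ys (here refl)  = y∈ys
  y∷xs⊆ys (there z∈xs) = xs⊆ys z∈xs

length≤1+length-filter¬ : ∀ {A : Set} {Q : A → Set} (Q? : Decidable Q) {xs} → Unique xs →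
                          (∀ {x y} → x ∈ xs → y ∈ xs → Q x → Q y → x ≡ y) →
                          length xs ≤ suc (length (filter (¬? ∘ Q?) xs))
length≤1+length-filter¬ Q? {xs} uniq Q-unique with Any.any? Q? xs
... | yes someQ = let c , c∈xs , Qc = find someQ in
  Unique-⊆⇒length≤ uniq λ {x} x∈xs → case Q? x of λ where
    (yes Qx) → here (Q-unique x∈xs c∈xs Qx Qc)
    (no ¬Qx) → there (∈-filter⁺ (¬? ∘ Q?) x∈xs ¬Qx)
... | no  noQ = m≤n⇒m≤1+n (Unique-⊆⇒length≤ uniq λ x∈xs →
  ∈-filter⁺ (¬? ∘ Q?) x∈xs (All.lookup (¬Any⇒All¬ xs noQ) x∈xs))

length-cartesianProduct : ∀ {A B : Set} (xs : List A) (ys : List B) →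
                          length (cartesianProduct xs ys) ≡ length xs * length ys
length-cartesianProduct []       ys = refl
length-cartesianProduct (x ∷ xs) ys = begin
  length (map (x ,_) ys ++ cartesianProduct xs ys)
    ≡⟨ length-++ (map (x ,_) ys) ⟩
  length (map (x ,_) ys) + length (cartesianProduct xs ys)
    ≡⟨ cong₂ _+_ (length-map (x ,_) ys) (length-cartesianProduct xs ys) ⟩
  length ys + length xs * length ys
    ∎
  where open ≡-Reasoning

length-concatMap : ∀ {A B : Set} (f : A → List B) xs → length (concatMap f xs) ≡ sum (map (length ∘ f) xs)
length-concatMap f []       = refl
length-concatMap f (x ∷ xs) = trans (length-++ (f x)) (cong (length (f x) +_) (length-concatMap f xs))

0<length⇒∃∈ : ∀ {A : Set} {xs : List A} → 0 < length xs → ∃ (_∈ xs)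
0<length⇒∃∈ {xs = x ∷ _} _ = x , here refl

take-Unique-length : ∀ {A : Set} k {xs : List A} → Unique xs → k ≤ length xs →
                     Unique (take k xs) × length (take k xs) ≡ k
take-Unique-length k {xs} uniq k≤|xs| = Unique.take⁺ k uniq , trans (length-take k xs) (m≤n⇒m⊓n≡m k≤|xs|)

∈-take⁻ : ∀ {A : Set} k {x : A} xs → x ∈ take k xs → x ∈ xs
∈-take⁻ k xs = Any-resp-⊆ (take-⊆ k xs)

updateAt-pointwise : ∀ {A : Set} {n} (P : Fin n → A → Set) (xs : Fin n → A) i {y} →
                     P i y → (∀ j → P j (xs j)) → ∀ j → P j (updateAt xs i (λ _ → y) j)
updateAt-pointwise P xs i Piy Pxs j with j Fin.≟ i
... | yes refl = subst (P i) (sym (updateAt-updates i xs)) Piy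
... | no  j≢i  = subst (P j) (sym (updateAt-minimal j i xs j≢i)) (Pxs j)

sum-map-bound : ∀ {A : Set} m e K (f : A → ℕ) xs → All (λ x → m * f x + e ≤ K) xs →
                m * sum (map f xs) + length xs * e ≤ length xs * K
sum-map-bound m e K f []       _     = ≤-reflexive (trans (+-identityʳ (m * 0)) (*-zeroʳ m))
sum-map-bound m e K f (x ∷ xs) (bound ∷ bounds) = begin
  m * (f x + sum (map f xs)) + (e + length xs * e)       ≡⟨ regroup m (f x) (sum (map f xs)) e (length xs * e) ⟩
  (m * f x + e) + (m * sum (map f xs) + length xs * e)   ≤⟨ +-mono-≤ bound (sum-map-bound m e K f xs bounds) ⟩
  K + length xs * K                                      ∎
  where
  open ≤-Reasoning
  regroup : ∀ m a s e t → m * (a + s) + (e + t) ≡ (m * a + e) + (m * s + t)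
  regroup = solve-∀

n≤n*n : ∀ n → n ≤ n * n
n≤n*n zero    = z≤n
n≤n*n (suc n) = m≤m*n (suc n) (suc n)

parity : ∀ k → k % 2 ≡ 0 ⊎ k % 2 ≡ 1
parity k with k % 2 | m%n<n k 2
... | 0           | _               = inj₁ refl
... | 1           | _               = inj₂ refl
... | suc (suc _) | s≤s (s≤s ())

square-split : ∀ p d → (p + (p + d)) * (p + (p + d)) ≡ 4 * (p * (p + d)) + d * d
square-split = solve-∀

-- With p ≤ q written as q = p + d: (p + q)² = 4pq + d², and d ≡ p + q (mod 2).
4pq+parity≤square-≤ : ∀ {p q k} → p ≤ q → p + q ≤ k → 4 * (p * q) + k % 2 ≤ k * k
4pq+parity≤square-≤ {p} p≤q p+q≤k with m≤n⇒∃[o]m+o≡n p≤q | m≤n⇒∃[o]m+o≡n p+q≤k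
... | d , refl | zero , refl = begin
  4 * (p * (p + d)) + (p + (p + d) + 0) % 2 ≡⟨ cong (λ m → 4 * (p * (p + d)) + m % 2) (as-d+2p p d) ⟩
  4 * (p * (p + d)) + (d + p * 2) % 2       ≡⟨ cong (4 * (p * (p + d)) +_) ([m+kn]%n≡m%n d p 2) ⟩
  4 * (p * (p + d)) + d % 2                 ≤⟨ +-monoʳ-≤ (4 * (p * (p + d))) (≤-trans (m%n≤m d 2) (n≤n*n d)) ⟩
  4 * (p * (p + d)) + d * d                 ≡⟨ square-split p d ⟨
  (p + (p + d)) * (p + (p + d))             ≡⟨ cong (λ m → m * m) (+-identityʳ (p + (p + d))) ⟨
  (p + (p + d) + 0) * (p + (p + d) + 0)     ∎
  where
  open ≤-Reasoning
  as-d+2p : ∀ p d → p + (p + d) + 0 ≡ d + p * 2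
  as-d+2p = solve-∀
... | d , refl | suc t , refl = begin
  4 * (p * (p + d)) + k % 2   ≤⟨ +-monoʳ-≤ (4 * (p * (p + d))) (≤-pred (m%n<n k 2)) ⟩
  4 * (p * (p + d)) + 1       ≤⟨ +-monoˡ-≤ 1 (≤-trans (m≤m+n _ (d * d)) (≤-reflexive (sym (square-split p d)))) ⟩
  s * s + 1                   ≡⟨ +-comm (s * s) 1 ⟩
  suc (s * s)                 ≤⟨ *-mono-< (m<m+n s (s≤s z≤n)) (m<m+n s (s≤s z≤n)) ⟩
  k * k                       ∎
  where
  open ≤-Reasoning
  s = p + (p + d)
  k = s + suc t

4pq+parity≤square : ∀ {p q k} → p + q ≤ k → 4 * (p * q) + k % 2 ≤ k * k
4pq+parity≤square {p} {q} {k} p+q≤k with ≤-total p q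
... | inj₁ p≤q = 4pq+parity≤square-≤ p≤q p+q≤k
... | inj₂ q≤p = subst (λ m → 4 * m + k % 2 ≤ k * k) (*-comm q p)
                   (4pq+parity≤square-≤ q≤p (subst (_≤ k) (+-comm p q) p+q≤k))

-- Summing 4pq+parity≤square over c lists that cover all K = k² pairs would give the
-- excluded inequality.
4K+c*parity≰c*K : ∀ {K c} k → 1 ≤ K → (k % 2 ≡ 0 → c ≤ 3) → (k % 2 ≡ 1 → c ≤ 4) →
          ¬ (4 * K + c * (k % 2) ≤ c * K)
4K+c*parity≰c*K {K} {c} k 1≤K even⇒c≤3 odd⇒c≤4 h with parity k
... | inj₁ even rewrite even = <⇒≱ (begin-strict
  c * K         ≤⟨ *-monoˡ-≤ K (even⇒c≤3 refl) ⟩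
  3 * K         ≡⟨ +-identityʳ (3 * K) ⟨
  3 * K + 0     <⟨ +-monoʳ-< (3 * K) 1≤K ⟩
  3 * K + K     ≡⟨ +-comm (3 * K) K ⟩
  4 * K         ≡⟨ +-identityʳ (4 * K) ⟨
  4 * K + 0     ≡⟨ cong (4 * K +_) (*-zeroʳ c) ⟨
  4 * K + c * 0 ∎) h
  where open ≤-Reasoning
... | inj₂ odd rewrite odd with c
...   | zero  = <⇒≱ (≤-trans 1≤K (≤-trans (m≤n*m K 4) (m≤m+n (4 * K) 0))) h
...   | suc c = <⇒≱ (begin-strict
  suc c * K           ≤⟨ *-monoˡ-≤ K (odd⇒c≤4 refl) ⟩
  4 * K               ≡⟨ +-identityʳ (4 * K) ⟨
  4 * K + 0           <⟨ +-monoʳ-< (4 * K) (s≤s z≤n) ⟩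
  4 * K + suc c * 1   ∎) h
  where open ≤-Reasoning

module _ {X Y : List ℕ} (uniqX : Unique X) (uniqY : Unique Y) (X#Y : Disjoint X Y) where

  pairsIn : List ℕ → List (ℕ × ℕ)
  pairsIn M = cartesianProduct (filter (_∈? M) X) (filter (_∈? M) Y)

  4*length-pairsIn+parity≤square : ∀ {k} M → length M ≤ k → 4 * length (pairsIn M) + k % 2 ≤ k * k
  4*length-pairsIn+parity≤square {k} M |M|≤k =
    subst (λ m → 4 * m + k % 2 ≤ k * k) (sym (length-cartesianProduct X∩M Y∩M))
      (4pq+parity≤square {length X∩M} {length Y∩M} (begin
        length X∩M + length Y∩M  ≡⟨ length-++ X∩M ⟨
        length (X∩M ++ Y∩M)      ≤⟨ Unique-⊆⇒length≤ uniq (λ x∈ → ∈-++⁻-in-M x∈) ⟩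
        length M                 ≤⟨ |M|≤k ⟩
        k                        ∎))
    where
    open ≤-Reasoning
    X∩M Y∩M : List ℕ
    X∩M = filter (_∈? M) X
    Y∩M = filter (_∈? M) Y
    uniq : Unique (X∩M ++ Y∩M)
    uniq = Unique.++⁺ (Unique.filter⁺ (_∈? M) uniqX) (Unique.filter⁺ (_∈? M) uniqY)
             (λ (x∈X∩M , x∈Y∩M) → X#Y ( proj₁ (∈-filter⁻ (_∈? M) {xs = X} x∈X∩M)
                                      , proj₁ (∈-filter⁻ (_∈? M) {xs = Y} x∈Y∩M)))
    ∈-++⁻-in-M : ∀ {x} → x ∈ X∩M ++ Y∩M → x ∈ M
    ∈-++⁻-in-M x∈ with ∈-++⁻ X∩M x∈
    ... | inj₁ x∈X∩M = proj₂ (∈-filter⁻ (_∈? M) {xs = X} x∈X∩M)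
    ... | inj₂ x∈Y∩M = proj₂ (∈-filter⁻ (_∈? M) {xs = Y} x∈Y∩M)

  Covers : List (List ℕ) → Set
  Covers Ms = ∀ {a b} → a ∈ X → b ∈ Y → Any (λ M → a ∈ M × b ∈ M) Ms

  covers⇒length*length≤ : ∀ Ms → Covers Ms → length X * length Y ≤ sum (map (length ∘ pairsIn) Ms)
  covers⇒length*length≤ Ms covers = begin
    length X * length Y                   ≡⟨ length-cartesianProduct X Y ⟨
    length (cartesianProduct X Y)         ≤⟨ Unique-⊆⇒length≤ (Unique.cartesianProduct⁺ uniqX uniqY) pairs⊆ ⟩
    length (concatMap pairsIn Ms)         ≡⟨ length-concatMap pairsIn Ms ⟩
    sum (map (length ∘ pairsIn) Ms)       ∎
    where
    open ≤-Reasoning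
    pairs⊆ : cartesianProduct X Y ⊆ concatMap pairsIn Ms
    pairs⊆ {a , b} ab∈XY with ∈-cartesianProduct⁻ X Y ab∈XY
    ... | a∈X , b∈Y with find (covers a∈X b∈Y)
    ...   | M , M∈Ms , a∈M , b∈M =
      ∈-concat⁺′ (∈-cartesianProduct⁺ (∈-filter⁺ (_∈? M) a∈X a∈M) (∈-filter⁺ (_∈? M) b∈Y b∈M))
                 (∈-map⁺ pairsIn M∈Ms)

  uncovered-pair : ∀ {k} Ms → length X ≡ k → length Y ≡ k → 1 ≤ k → All (λ M → length M ≤ k) Ms →
                   (k % 2 ≡ 0 → length Ms ≤ 3) → (k % 2 ≡ 1 → length Ms ≤ 4) →
                   Any (λ a → Any (λ b → All (λ M → ¬ (a ∈ M × b ∈ M)) Ms) Y) X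
  uncovered-pair {k} Ms refl |Y|≡k 1≤k short even⇒ odd⇒
    with Any.any? (λ a → Any.any? (λ b → All.all? (λ M → ¬? (a ∈? M ×-dec b ∈? M)) Ms) Y) X
  ... | yes uncovered = uncovered
  ... | no  ¬uncovered = contradiction total-bound (4K+c*parity≰c*K k (*-mono-≤ 1≤k 1≤k) even⇒ odd⇒)
    where
    open ≤-Reasoning
    covers : Covers Ms
    covers {a} {b} a∈X b∈Y =
      Any.map (decidable-stable (a ∈? _ ×-dec b ∈? _))
        (¬All⇒Any¬ (λ M → ¬? (a ∈? M ×-dec b ∈? M)) Ms
          (All.lookup (¬Any⇒All¬ Y (All.lookup (¬Any⇒All¬ X ¬uncovered) a∈X)) b∈Y))
    total-bound : 4 * (k * k) + length Ms * (k % 2) ≤ length Ms * (k * k)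
    total-bound = begin
      4 * (k * k) + length Ms * (k % 2)
        ≤⟨ +-monoˡ-≤ _ (*-monoʳ-≤ 4 (subst (λ m → k * m ≤ sum (map (length ∘ pairsIn) Ms)) |Y|≡k
                                          (covers⇒length*length≤ Ms covers))) ⟩
      4 * sum (map (length ∘ pairsIn) Ms) + length Ms * (k % 2)
        ≤⟨ sum-map-bound 4 (k % 2) (k * k) (length ∘ pairsIn) Ms
             (All.map (4*length-pairsIn+parity≤square _) short) ⟩
      length Ms * (k * k) ∎

∣p∩q∣<∣p∣⇒∃∈p∖q : ∀ {n} (p q : Subset n) → ∣ p ∩ q ∣ < ∣ p ∣ → ∃ λ x → x ∈ₛ p × x ∉ₛ q
∣p∩q∣<∣p∣⇒∃∈p∖q {n} p q |p∩q|<|p|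
  with ¬∀⟶∃¬ n (λ x → x ∈ₛ p → x ∈ₛ q) (λ x → x ∈ₛ? p →-dec x ∈ₛ? q)
         (λ p⊆q → <⇒≱ |p∩q|<|p| (p⊆q⇒∣p∣≤∣q∣ (λ x∈p → x∈p∩q⁺ (x∈p , p⊆q _ x∈p))))
... | x , x∈p⇏x∈q = x , decidable-stable (x ∈ₛ? p) (λ x∉p → x∈p⇏x∈q (λ x∈p → contradiction x∈p x∉p))
                      , λ x∈q → x∈p⇏x∈q (λ _ → x∈q)

elements : ∀ {n} → Subset n → List (Fin n)
elements []            = []
elements (inside ∷ p)  = zero ∷ map suc (elements p)
elements (outside ∷ p) = map suc (elements p)

length-elements : ∀ {n} (p : Subset n) → length (elements p) ≡ ∣ p ∣
length-elements []            = refl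
length-elements (inside ∷ p)  = cong suc (trans (length-map suc (elements p)) (length-elements p))
length-elements (outside ∷ p) = trans (length-map suc (elements p)) (length-elements p)

∈-elements : ∀ {n} {x : Fin n} {p} → x ∈ₛ p → x ∈ elements p
∈-elements {p = inside ∷ p}  Vec.here        = here refl
∈-elements {p = inside ∷ p}  (Vec.there x∈p) = there (∈-map⁺ suc (∈-elements x∈p))
∈-elements {p = outside ∷ p} (Vec.there x∈p) = ∈-map⁺ suc (∈-elements x∈p)

LColorable-⊆ : ∀ {n} {G : Graph n} {L L′ : ListAssignment n} →
               (∀ v → L v ⊆ L′ v) → LColorable G L → LColorable G L′
LColorable-⊆ L⊆L′ (c , c∈L , proper) = c , (λ v → L⊆L′ v (c∈L v)) , proper

Colorable-mono : ∀ {n} {G : Graph n} {m m′} → m ≤ m′ → Colorable G m → Colorable G m′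
Colorable-mono m≤m′ (c , proper) =
  (λ v → inject≤ (c v) m≤m′) , λ u v uv → proper u v uv ∘ inject≤-injective m≤m′ m≤m′ (c u) (c v)

-- u and s are not adjacent, so both may take the one new colour.
extend-colorable : ∀ {n} {G : Graph n} {k} A B → Colorable G k → Colorable (extend G A B) (suc k)
extend-colorable {n} {G} {k} A B (c , proper) = c′ , proper′
  where
  c′ : Fin (suc (suc n)) → Fin (suc k)
  c′ zero          = fromℕ k
  c′ (suc zero)    = fromℕ k
  c′ (suc (suc v)) = inject₁ (c v)
  proper′ : Proper (extend G A B) c′
  proper′ zero          (suc (suc v)) _  = fromℕ≢inject₁
  proper′ (suc zero)    (suc (suc v)) _  = fromℕ≢inject₁
  proper′ (suc (suc v)) zero          _  = fromℕ≢inject₁ ∘ sym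
  proper′ (suc (suc v)) (suc zero)    _  = fromℕ≢inject₁ ∘ sym
  proper′ (suc (suc v)) (suc (suc w)) vw = proper v w vw ∘ inject₁-injective

-- If w were the only vertex, colouring it from R w would be proper.
uncolorable⇒∃≢ : ∀ {n} (G : Graph n) (R : ListAssignment n) → (∀ v → ∃ (_∈ R v)) →
                 ¬ LColorable G R → ∀ w → ∃ λ v → v ≢ w
uncolorable⇒∃≢ {n} G R nonempty ¬col w = ¬∀⟶∃¬ n (_≡ w) (Fin._≟ w) λ all≡w →
  ¬col ( (λ _ → proj₁ (nonempty w))
       , (λ v → subst (λ u → proj₁ (nonempty w) ∈ R u) (sym (all≡w v)) (proj₂ (nonempty w)))
       , λ u v uv _ → case trans (sym uv) (adj≡false u v (all≡w u) (all≡w v)) of λ ())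
  where
  adj≡false : ∀ u v → u ≡ w → v ≡ w → adj G u v ≡ false
  adj≡false _ _ refl refl = irrefl G w

⊆-common⇒Constant : ∀ {m k} (L : ListAssignment m) (X : List ℕ) → IsAssignment k L → length X ≤ k →
                    (∀ p → L p ⊆ X) → Constant L
⊆-common⇒Constant L X L-assignment |X|≤k L⊆X p q x = mk⇔ (move p q) (move q p)
  where
  move : ∀ p q → x ∈ L p → x ∈ L q
  move p q = Unique-⊆-length≥⇒⊇ _≟_ (proj₁ (L-assignment q)) (L⊆X q)
               (subst (length X ≤_) (sym (proj₂ (L-assignment q))) |X|≤k) ∘ L⊆X p

module _ {n} {G : Graph n} {m} (strong : ∀ L → IsAssignment (suc m) L → ¬ LColorable G L → Constant L)
         (R : ListAssignment n) (long : ∀ v → Unique (R v) × suc m ≤ length (R v)) (¬col : ¬ LColorable G R)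
         where

  private
    R′ : ListAssignment n
    R′ v = take (suc m) (R v)

    R′-assignment : IsAssignment (suc m) R′
    R′-assignment v = take-Unique-length (suc m) (proj₁ (long v)) (proj₂ (long v))

    R′-constant : Constant R′
    R′-constant = strong R′ R′-assignment (¬col ∘ LColorable-⊆ {G = G} (λ v → ∈-take⁻ (suc m) (R v)))

    nonempty : ∀ v → ∃ (_∈ R v)
    nonempty v = 0<length⇒∃∈ (≤-trans (s≤s z≤n) (proj₂ (long v)))

    -- If R w = x ∷ rest had more than m + 1 elements, truncating rest instead of R w at w
    -- would give a second constant assignment, which forces x ∈ rest.
    ¬longer : ∀ w x rest → R w ≡ x ∷ rest → ¬ (suc m ≤ length rest)
    ¬longer w x rest Rw≡x∷rest m<|rest|
      with subst Unique Rw≡x∷rest (proj₁ (long w)) | uncolorable⇒∃≢ G R nonempty ¬col w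
    ... | x≢rest ∷ uniq-rest | v , v≢w = All¬⇒¬Any x≢rest x∈rest
      where
      R″ : ListAssignment n
      R″ = updateAt R′ w (λ _ → take (suc m) rest)
      R″-constant : Constant R″
      R″-constant = strong R″
        (updateAt-pointwise (λ _ xs → Unique xs × length xs ≡ suc m) R′ w
           (take-Unique-length (suc m) uniq-rest m<|rest|) R′-assignment)
        (¬col ∘ LColorable-⊆ {G = G} (updateAt-pointwise (λ u xs → xs ⊆ R u) R′ w
           (λ y∈ → subst (_ ∈_) (sym Rw≡x∷rest) (there (∈-take⁻ (suc m) rest y∈)))
           (λ u → ∈-take⁻ (suc m) (R u))))
      x∈R′w : x ∈ R′ w
      x∈R′w = subst (λ xs → x ∈ take (suc m) xs) (sym Rw≡x∷rest) (here refl)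
      x∈rest : x ∈ rest
      x∈rest = ∈-take⁻ (suc m) rest (subst (x ∈_) (updateAt-updates w R′)
                 (to (R″-constant v w x) (subst (x ∈_) (sym (updateAt-minimal v w R′ v≢w))
                   (to (R′-constant w v x) x∈R′w))))

    short : ∀ w → length (R w) ≤ suc m
    short w with R w in Rw≡ | length (R w) ≤? suc m
    ... | _        | yes |Rw|≤m = |Rw|≤m
    ... | []       | no  |Rw|≰m = contradiction z≤n |Rw|≰m
    ... | x ∷ rest | no |Rw|≰m = contradiction (≤-pred (≰⇒> |Rw|≰m)) (¬longer w x rest Rw≡)

  uncolorable⇒tight∧constant : IsAssignment (suc m) R × Constant R
  uncolorable⇒tight∧constant =
      (λ v → proj₁ (long v) , ≤-antisym (short v) (proj₂ (long v)))
    , λ u v x → subst₂ (λ Ru Rv → (x ∈ Ru) ⇔ (x ∈ Rv)) (R′≡R u) (R′≡R v) (R′-constant u v x)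
    where
    R′≡R : ∀ v → R′ v ≡ R v
    R′≡R v = take-all (suc m) (R v) (short v)

module Extension {j n} {G : Graph n} (strong : ∀ L → IsAssignment (suc j) L → ¬ LColorable G L → Constant L)
                 (A B : Subset n) {wA wB : Fin n}
                 (wA∈A : wA ∈ₛ A) (wA∉B : wA ∉ₛ B) (wB∈B : wB ∈ₛ B) (wB∉A : wB ∉ₛ A)
                 (L : ListAssignment (suc (suc n))) (L-assignment : IsAssignment (suc (suc j)) L)
                 (¬col : ¬ LColorable (extend G A B) L)
                 where

  Lu Ls : List ℕ
  Lu = L zero
  Ls = L (suc zero)

  Lv : ListAssignment n
  Lv v = L (suc (suc v))

  Removed : ℕ → ℕ → Fin n → ℕ → Set
  Removed a b v x = (v ∈ₛ A × x ≡ a) ⊎ (v ∈ₛ B × x ≡ b)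

  removed? : ∀ a b v → Decidable (Removed a b v)
  removed? a b v x = (v ∈ₛ? A ×-dec x ≟ a) ⊎-dec (v ∈ₛ? B ×-dec x ≟ b)

  residual : ℕ → ℕ → ListAssignment n
  residual a b v = filter (¬? ∘ removed? a b v) (Lv v)

  ∈-residual⊎Removed : ∀ {a b v x} → x ∈ Lv v → x ∈ residual a b v ⊎ Removed a b v x
  ∈-residual⊎Removed {a} {b} {v} {x} x∈Lv with removed? a b v x
  ... | yes removed = inj₂ removed
  ... | no  kept    = inj₁ (∈-filter⁺ (¬? ∘ removed? a b v) x∈Lv kept)

  ∈-residual⁻ : ∀ {a b v x} → x ∈ residual a b v → x ∈ Lv v
  ∈-residual⁻ {a} {b} {v} = proj₁ ∘ ∈-filter⁻ (¬? ∘ removed? a b v) {xs = Lv v}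

  residual-uncolorable : ∀ {a b} → a ∈ Lu → b ∈ Ls → ¬ LColorable G (residual a b)
  residual-uncolorable {a} {b} a∈Lu b∈Ls (c , c∈residual , proper) = ¬col (c′ , c′∈L , proper′)
    where
    c′ : Fin (suc (suc n)) → ℕ
    c′ zero          = a
    c′ (suc zero)    = b
    c′ (suc (suc v)) = c v
    c′∈L : ∀ p → c′ p ∈ L p
    c′∈L zero          = a∈Lu
    c′∈L (suc zero)    = b∈Ls
    c′∈L (suc (suc v)) = ∈-residual⁻ (c∈residual v)
    kept : ∀ v → ¬ Removed a b v (c v)
    kept v = proj₂ (∈-filter⁻ (¬? ∘ removed? a b v) {xs = Lv v} (c∈residual v))
    proper′ : Proper (extend G A B) c′
    proper′ zero          (suc (suc v)) uv a≡cv = kept v (inj₁ (lookup⇒[]= v A uv , sym a≡cv))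
    proper′ (suc zero)    (suc (suc v)) sv b≡cv = kept v (inj₂ (lookup⇒[]= v B sv , sym b≡cv))
    proper′ (suc (suc v)) zero          vu cv≡a = kept v (inj₁ (lookup⇒[]= v A vu , cv≡a))
    proper′ (suc (suc v)) (suc zero)    vs cv≡b = kept v (inj₂ (lookup⇒[]= v B vs , cv≡b))
    proper′ (suc (suc v)) (suc (suc w)) vw      = proper v w vw

  Separated : ℕ → ℕ → Set
  Separated a b = ∀ v → v ∈ₛ A → v ∈ₛ B → a ∈ Lv v → b ∈ Lv v → a ≡ b

  separated⇒Removed-unique : ∀ {a b} → Separated a b → ∀ v {x y} → x ∈ Lv v → y ∈ Lv v →
                             Removed a b v x → Removed a b v y → x ≡ y
  separated⇒Removed-unique sep v _   _   (inj₁ (_ , refl))   (inj₁ (_ , refl))   = refl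
  separated⇒Removed-unique sep v _   _   (inj₂ (_ , refl))   (inj₂ (_ , refl))   = refl
  separated⇒Removed-unique sep v x∈ y∈ (inj₁ (v∈A , refl)) (inj₂ (v∈B , refl)) = sep v v∈A v∈B x∈ y∈
  separated⇒Removed-unique sep v x∈ y∈ (inj₂ (v∈B , refl)) (inj₁ (v∈A , refl)) = sym (sep v v∈A v∈B y∈ x∈)

  ResidualConstant : ℕ → ℕ → Set
  ResidualConstant a b = IsAssignment (suc j) (residual a b) × Constant (residual a b)

  separated⇒ResidualConstant : ∀ {a b} → a ∈ Lu → b ∈ Ls → Separated a b → ResidualConstant a b
  separated⇒ResidualConstant {a} {b} a∈Lu b∈Ls sep =
    uncolorable⇒tight∧constant {G = G} strong (residual a b) long (residual-uncolorable a∈Lu b∈Ls)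
    where
    long : ∀ v → Unique (residual a b v) × suc j ≤ length (residual a b v)
    long v = Unique.filter⁺ (¬? ∘ removed? a b v) (proj₁ (L-assignment _))
           , ≤-pred (subst (_≤ suc (length (residual a b v))) (proj₂ (L-assignment _))
                (length≤1+length-filter¬ (removed? a b v) (proj₁ (L-assignment _)) (separated⇒Removed-unique sep v)))

  tight⇒∃Removed : ∀ {a b} → IsAssignment (suc j) (residual a b) →
                   ∀ v → ∃ λ x → x ∈ Lv v × Removed a b v x
  tight⇒∃Removed {a} {b} tight v with Any.any? (removed? a b v) (Lv v)
  ... | yes someRemoved = find someRemoved
  ... | no  noneRemoved = contradiction full (<⇒≱ (n<1+n (suc j)))
    where
    full : suc (suc j) ≤ suc j
    full = begin
      suc (suc j)             ≡⟨ proj₂ (L-assignment _) ⟨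
      length (Lv v)           ≤⟨ Unique-⊆⇒length≤ (proj₁ (L-assignment _)) Lv⊆residual ⟩
      length (residual a b v) ≡⟨ proj₂ (tight v) ⟩
      suc j                   ∎
      where
      open ≤-Reasoning
      Lv⊆residual : Lv v ⊆ residual a b v
      Lv⊆residual x∈ = ∈-filter⁺ (¬? ∘ removed? a b v) x∈ (All.lookup (¬Any⇒All¬ (Lv v) noneRemoved) x∈)

  tight⇒a∈LwA : ∀ {a b} → IsAssignment (suc j) (residual a b) → a ∈ Lv wA
  tight⇒a∈LwA tight with tight⇒∃Removed tight wA
  ... | _ , x∈ , inj₁ (_ , refl)   = x∈
  ... | _ , _  , inj₂ (wA∈B , _)   = contradiction wA∈B wA∉B

  tight⇒b∈LwB : ∀ {a b} → IsAssignment (suc j) (residual a b) → b ∈ Lv wB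
  tight⇒b∈LwB tight with tight⇒∃Removed tight wB
  ... | _ , x∈ , inj₂ (_ , refl)   = x∈
  ... | _ , _  , inj₁ (wB∈A , _)   = contradiction wB∈A wB∉A

  module _ {a b} (rc : ResidualConstant a b) where

    ∈Lv⇒≡b⊎∈LwA : ∀ {x w} → x ∈ Lv w → x ≡ b ⊎ x ∈ Lv wA
    ∈Lv⇒≡b⊎∈LwA {x} {w} x∈ with ∈-residual⊎Removed {a} {b} x∈
    ... | inj₁ x∈residual   = inj₂ (∈-residual⁻ (to (proj₂ rc w wA x) x∈residual))
    ... | inj₂ (inj₁ (_ , refl)) = inj₂ (tight⇒a∈LwA {a} {b} (proj₁ rc))
    ... | inj₂ (inj₂ (_ , x≡b))  = inj₁ x≡b

    ∈Lv⇒≡a⊎∈LwB : ∀ {x w} → x ∈ Lv w → x ≡ a ⊎ x ∈ Lv wB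
    ∈Lv⇒≡a⊎∈LwB {x} {w} x∈ with ∈-residual⊎Removed {a} {b} x∈
    ... | inj₁ x∈residual   = inj₂ (∈-residual⁻ (to (proj₂ rc w wB x) x∈residual))
    ... | inj₂ (inj₁ (_ , x≡a))  = inj₁ x≡a
    ... | inj₂ (inj₂ (_ , refl)) = inj₂ (tight⇒b∈LwB {a} {b} (proj₁ rc))

  some-colour : ∀ p → ∃ (_∈ L p)
  some-colour p = 0<length⇒∃∈ {xs = L p} (subst (0 <_) (sym (proj₂ (L-assignment p))) (s≤s z≤n))

  -- A colour x ∈ Lu missing from every Lv w makes (x, b) separated, so the residual
  -- lists at (x, b) are tight, which puts x into Lv wA after all.
  Lu⊆LwA : (∀ {x} → x ∈ Lu → ∀ w → x ∈ Lv w → x ∈ Lv wA) → Lu ⊆ Lv wA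
  Lu⊆LwA closed {x} x∈Lu with x ∈? Lv wA | some-colour (suc zero)
  ... | yes x∈LwA | _        = x∈LwA
  ... | no  x∉LwA | b , b∈Ls = tight⇒a∈LwA {x} {b} (proj₁ (separated⇒ResidualConstant x∈Lu b∈Ls separated))
    where
    separated : Separated x b
    separated v _ _ x∈Lv _ = contradiction (closed x∈Lu v x∈Lv) x∉LwA

  Ls⊆LwB : (∀ {x} → x ∈ Ls → ∀ w → x ∈ Lv w → x ∈ Lv wB) → Ls ⊆ Lv wB
  Ls⊆LwB closed {x} x∈Ls with x ∈? Lv wB | some-colour zero
  ... | yes x∈LwB | _        = x∈LwB
  ... | no  x∉LwB | a , a∈Lu = tight⇒b∈LwB {a} {x} (proj₁ (separated⇒ResidualConstant a∈Lu x∈Ls separated))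
    where
    separated : Separated a x
    separated v _ _ _ x∈Lv = contradiction (closed x∈Ls v x∈Lv) x∉LwB

  common-colour⇒Constant : ∀ {a} → a ∈ Lu → a ∈ Ls → Constant L
  common-colour⇒Constant {a} a∈Lu a∈Ls =
    ⊆-common⇒Constant L (Lv wA) L-assignment (≤-reflexive (proj₂ (L-assignment _))) L⊆LwA
    where
    rc : ResidualConstant a a
    rc = separated⇒ResidualConstant a∈Lu a∈Ls (λ _ _ _ _ _ → refl)
    Lv⊆LwA : ∀ w → Lv w ⊆ Lv wA
    Lv⊆LwA w x∈ with ∈Lv⇒≡b⊎∈LwA rc x∈
    ... | inj₁ refl  = tight⇒a∈LwA {a} {a} (proj₁ rc)
    ... | inj₂ x∈LwA = x∈LwA
    Lv⊆LwB : ∀ w → Lv w ⊆ Lv wB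
    Lv⊆LwB w x∈ with ∈Lv⇒≡a⊎∈LwB rc x∈
    ... | inj₁ refl  = tight⇒b∈LwB {a} {a} (proj₁ rc)
    ... | inj₂ x∈LwB = x∈LwB
    L⊆LwA : ∀ p → L p ⊆ Lv wA
    L⊆LwA zero          = Lu⊆LwA (λ _ w → Lv⊆LwA w)
    L⊆LwA (suc zero)    = Lv⊆LwA wB ∘ Ls⊆LwB (λ _ w → Lv⊆LwB w)
    L⊆LwA (suc (suc w)) = Lv⊆LwA w

  uniq-Lu : Unique Lu
  uniq-Lu = proj₁ (L-assignment zero)

  uniq-Ls : Unique Ls
  uniq-Ls = proj₁ (L-assignment (suc zero))

  length-L≤ : ∀ p q → length (L p) ≤ length (L q)
  length-L≤ p q = ≤-reflexive (trans (proj₂ (L-assignment p)) (sym (proj₂ (L-assignment q))))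

  C : List (Fin n)
  C = elements (A ∩ B)

  Ms : List (List ℕ)
  Ms = map Lv C

  |Ms|≡|C| : length Ms ≡ ∣ A ∩ B ∣
  |Ms|≡|C| = trans (length-map Lv C) (length-elements (A ∩ B))

  disjoint-impossible : (suc (suc j) % 2 ≡ 0 → ∣ A ∩ B ∣ ≤ 3) → (suc (suc j) % 2 ≡ 1 → ∣ A ∩ B ∣ ≤ 4) →
                        ¬ Disjoint Lu Ls
  disjoint-impossible even⇒ odd⇒ Lu#Ls
    with find (uncovered-pair uniq-Lu uniq-Ls Lu#Ls Ms (proj₂ (L-assignment _)) (proj₂ (L-assignment _)) (s≤s z≤n)
                 (map⁺ (All.universal (λ v → ≤-reflexive (proj₂ (L-assignment _))) C))
                 (subst (_≤ 3) (sym |Ms|≡|C|) ∘ even⇒) (subst (_≤ 4) (sym |Ms|≡|C|) ∘ odd⇒))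
  ... | a , a∈Lu , uncoveredₐ with find uncoveredₐ
  ...   | b , b∈Ls , uncovered = Lu#Ls (y∈Lu , y∈Ls)
    where
    separated : Separated a b
    separated v v∈A v∈B a∈Lv b∈Lv =
      contradiction (a∈Lv , b∈Lv) (All.lookup uncovered (∈-map⁺ Lv (∈-elements (x∈p∩q⁺ (v∈A , v∈B)))))
    rc : ResidualConstant a b
    rc = separated⇒ResidualConstant a∈Lu b∈Ls separated
    LwA⊆Lu : Lv wA ⊆ Lu
    LwA⊆Lu = Unique-⊆-length≥⇒⊇ _≟_ uniq-Lu (Lu⊆LwA closed) (length-L≤ _ _)
      where
      closed : ∀ {x} → x ∈ Lu → ∀ w → x ∈ Lv w → x ∈ Lv wA
      closed x∈Lu w x∈Lv with ∈Lv⇒≡b⊎∈LwA rc x∈Lv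
      ... | inj₁ refl  = contradiction (x∈Lu , b∈Ls) Lu#Ls
      ... | inj₂ x∈LwA = x∈LwA
    LwB⊆Ls : Lv wB ⊆ Ls
    LwB⊆Ls = Unique-⊆-length≥⇒⊇ _≟_ uniq-Ls (Ls⊆LwB closed) (length-L≤ _ _)
      where
      closed : ∀ {x} → x ∈ Ls → ∀ w → x ∈ Lv w → x ∈ Lv wB
      closed x∈Ls w x∈Lv with ∈Lv⇒≡a⊎∈LwB rc x∈Lv
      ... | inj₁ refl  = contradiction (a∈Lu , x∈Ls) Lu#Ls
      ... | inj₂ x∈LwB = x∈LwB
    y-in-residual : ∃ (_∈ residual a b wA)
    y-in-residual = 0<length⇒∃∈ (subst (0 <_) (sym (proj₂ (proj₁ rc wA))) (s≤s z≤n))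
    y = proj₁ y-in-residual
    y∈Lu : y ∈ Lu
    y∈Lu = LwA⊆Lu (∈-residual⁻ (proj₂ y-in-residual))
    y∈Ls : y ∈ Ls
    y∈Ls = LwB⊆Ls (∈-residual⁻ (to (proj₂ rc wA wB y) (proj₂ y-in-residual)))

  L-constant : (suc (suc j) % 2 ≡ 0 → ∣ A ∩ B ∣ ≤ 3) → (suc (suc j) % 2 ≡ 1 → ∣ A ∩ B ∣ ≤ 4) →
               Constant L
  L-constant even⇒ odd⇒ with Any.any? (_∈? Ls) Lu
  ... | yes common = let _ , a∈Lu , a∈Ls = find common in common-colour⇒Constant a∈Lu a∈Ls
  ... | no  none   = contradiction (λ {x} (x∈Lu , x∈Ls) → none (Any.map (λ { refl → x∈Ls }) x∈Lu))
                                   (disjoint-impossible even⇒ odd⇒)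

lemma2p2 : (k n : ℕ) → 2 ≤ k → (G : Graph n) → StrongChromaticChoosable G k →
    (A B : Subset n) → A ∪ B ≡ ⊤ →
    ∣ A ∩ B ∣ < ∣ A ∣ → ∣ A ∩ B ∣ < ∣ B ∣ → 0 < ∣ A ∩ B ∣ →
    (k % 2 ≡ 0 → ∣ A ∩ B ∣ ≤ 3) → (k % 2 ≡ 1 → ∣ A ∩ B ∣ ≤ 4) →
    ¬ Colorable (extend G A B) k →
    StrongChromaticChoosable (extend G A B) (suc k)
lemma2p2 (suc (suc j)) n (s≤s (s≤s z≤n)) G ((colorable , _) , strong) A B _ |C|<|A| |C|<|B| _
         even⇒ odd⇒ ¬k-colorable
  with ∣p∩q∣<∣p∣⇒∃∈p∖q A B |C|<|A|
     | ∣p∩q∣<∣p∣⇒∃∈p∖q B A (subst (_< ∣ B ∣) (cong ∣_∣ (∩-comm A B)) |C|<|B|)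
... | wA , wA∈A , wA∉B | wB , wB∈B , wB∉A =
    (extend-colorable A B colorable , λ m m<k+1 → ¬k-colorable ∘ Colorable-mono {G = extend G A B} (≤-pred m<k+1))
  , λ L L-assignment ¬col →
      Extension.L-constant strong A B wA∈A wA∉B wB∈B wB∉A L L-assignment ¬col even⇒ odd⇒
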